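{- Let $\mathcal X$ be a scheme on $\Omega$ satisfying the $e_1/e_0$-condition, $\mathcal X'$ a scheme on $\Omega'$, and $\varphi:\mathcal X\to\mathcal X'$ an algebraic isomorphism such that for all $\alpha\in\Omega$, $\alpha'\in\Omega'$, $$\mathrm{Iso}_{\alpha_0,\alpha'_0}(\mathcal X_0,\mathcal X'_0,\varphi_0)^{\Delta_0}=\mathrm{Iso}_{\alpha,\alpha'}(\mathcal X_1,\mathcal X'_1,\varphi_1)^{\Delta_0}.$$ Then for all $\alpha\in\Omega$ and $\alpha'\in\Omega'$ the following are equivalent: (1) $\mathrm{Iso}_{\alpha,\alpha'}(\mathcal X,\mathcal X',\varphi)\ne\emptyset$; (2) $\mathrm{Iso}_{\alpha_0,\alpha'_0}(\mathcal X_0,\mathcal X'_0,\varphi_0)\ne\emptyset$; (3) $\mathrm{Iso}_{\alpha,\alpha'}(\mathcal X_1,\mathcal X'_1,\varphi_1)\ne\emptyset$.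
   Context: A coherent configuration $\mathcal X=(\Omega,S)$ ($\Omega$ finite) is a partition $S$ of $\Omega^2$ with $1_\Omega$ a union of elements of $S$, closed under transposition, with intersection numbers $c_{rs}^t=|\alpha r\cap\beta s^*|$ independent of $(\alpha,\beta)\in t$; a scheme if $1_\Omega\in S$. Relations are unions of elements of $S$; parabolics are relations that are equivalence relations. An algebraic isomorphism $\varphi:\mathcal X\to\mathcal X'$ is a bijection $S\to S'$ preserving intersection numbers (extended by unions). $\mathrm{Iso}(\mathcal X,\mathcal X',\varphi)$ is the set of bijections $f$ with $s^f=\varphi(s)$ for all $s\in S$; $\mathrm{Iso}_{\beta,\beta'}(\cdot)$ is its subset with $\beta^f=\beta'$. For an equivalence relation $e$ and $s\subseteq\Omega^2$, $s_{\Omega/e}=\{(\Gamma,\Gamma'):s\cap(\Gamma\times\Gamma')\ne\emptyset\}$; $\mathrm{rad}(s)$ is the largest equivalence relation $e$ with $s=\bigcup_{(\Gamma,\Gamma')\in s_{\Omega/e}}\Gamma\times\Gamma'$. For parabolics $e_0\subseteq e_1$, $\mathcal X$ satisfies the $e_1/e_0$-condition if $s\cap e_1=\emptyset\Rightarrow e_0\subseteq\mathrm{rad}(s)$ for all $s\in S$. Notation: $e'_i=\varphi(e_i)$; $\Omega_0=\Omega/e_0$; $\mathcal X_0$, $\mathcal X'_0$ are the quotient schemes modulo $e_0$, $e'_0$ (basis relations $s_{\Omega/e_0}$); $\varphi_0:s_{\Omega/e_0}\mapsto\varphi(s)_{\Omega'/e'_0}$. For $\alpha,\alpha'$: $\alpha_0=\alpha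 e_0$, $\alpha'_0=\alpha'e'_0$; $\Delta$ is the $e_1$-class of $\alpha$, $\Delta'$ the $e'_1$-class of $\alpha'$; $\Delta_0=\Delta/e_0$, $\Delta'_0=\Delta'/e'_0$; $\mathcal X_1=\mathcal X_\Delta$, $\mathcal X'_1=\mathcal X'_{\Delta'}$ are restrictions (basis relations the nonempty $s\cap\Delta^2$); $\varphi_1:s\cap\Delta^2\mapsto\varphi(s)\cap\Delta'^2$. For a set $B$ of bijections, $B^{\Delta_0}$ denotes the set of bijections $\Delta_0\to\Delta'_0$ obtained from elements of $B$ that map $\Delta_0$ onto $\Delta'_0$ (by restriction, for maps $\Omega_0\to\Omega'_0$) or map $e_0$-classes in $\Delta$ onto $e'_0$-classes in $\Delta'$ (by the induced map, for maps $\Delta\to\Delta'$). -}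

module Defs where

open import Data.Nat using (ℕ)
open import Data.Fin using (Fin; _≟_)
open import Data.Bool using (Bool; T)
open import Data.List using (List; length; filter; allFin)
open import Data.Product using (Σ; ∃; _×_; _,_; proj₁)
open import Relation.Nullary using (¬_)
open import Relation.Nullary.Decidable using (_×-dec_)
open import Relation.Binary.PropositionalEquality using (_≡_)
open import Relation.Binary.Structures using (IsEquivalence)
open import Function.Bundles using (Inverse; _↔_; _⇔_)

-- Point set Ω = Fin n; the partition S of Ω² is given by a colouring
-- col : Ω → Ω → Fin r, basis relation t = {(a,b) : col a b ≡ t}.

-- intersection-number count  |α s ∩ β t*| = #{γ : col α γ ≡ s , col γ β ≡ t}
isn : {n r : ℕ} → (Fin n → Fin n → Fin r) → Fin r → Fin r → Fin n → Fin n → ℕ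
isn {n} col s t a b =
  length (filter (λ g → (col a g ≟ s) ×-dec (col g b ≟ t)) (allFin n))

record CC : Set where
  field
    n   : ℕ
    r   : ℕ
    col : Fin n → Fin n → Fin r
    partition : ∀ t → ∃ λ a → ∃ λ b → col a b ≡ t
    -- 1_Ω is a union of basis relations
    diagUnion : ∀ a b c → col a a ≡ col b c → b ≡ c
    transp : ∀ a b a' b' → col a b ≡ col a' b' → col b a ≡ col b' a'
    coherent : ∀ (s t : Fin r) a b a' b' → col a b ≡ col a' b' →
               isn col s t a b ≡ isn col s t a' b'

open CC public

IsScheme : CC → Set
IsScheme X = ∃ λ (d : Fin (r X)) → ∀ a b → (col X a b ≡ d → a ≡ b) × (a ≡ b → col X a b ≡ d)

record AlgIso (X X' : CC) : Set where
  field
    bij  : Fin (r X) ↔ Fin (r X')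
    pres : ∀ s t a b a' b' → Inverse.to bij (col X a b) ≡ col X' a' b' →
           isn (col X) s t a b ≡ isn (col X') (Inverse.to bij s) (Inverse.to bij t) a' b'

open AlgIso public

φ⟨_⟩ : {X X' : CC} → AlgIso X X' → Fin (r X) → Fin (r X')
φ⟨ φ ⟩ = Inverse.to (bij φ)

-- A relation (union of basis relations) is a set of colours.
Rel : CC → Set
Rel X = Fin (r X) → Bool

E : (X : CC) → Rel X → Fin (n X) → Fin (n X) → Set
E X e a b = T (e (col X a b))

IsParabolic : (X : CC) → Rel X → Set
IsParabolic X e = IsEquivalence (E X e)

RelSub : (X : CC) → Rel X → Rel X → Set
RelSub X e f = ∀ t → T (e t) → T (f t)

φRel : {X X' : CC} → AlgIso X X' → Rel X → Rel X'
φRel φ e t' = e (Inverse.from (bij φ) t')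

-- (aE, bE) ∈ s_{Ω/e}  :  s ∩ (aE × bE) ≠ ∅
InQ : (X : CC) → Rel X → Fin (r X) → Fin (n X) → Fin (n X) → Set
InQ X e s a b = ∃ λ a₁ → ∃ λ b₁ → E X e a a₁ × E X e b b₁ × col X a₁ b₁ ≡ s

-- e ⊆ rad(s) :  s = ⋃_{(Γ,Γ') ∈ s_{Ω/e}} Γ × Γ'
-- (the inclusion ⊆ is trivial; we state the set equality pointwise)
InRad : (X : CC) → Rel X → Fin (r X) → Set
InRad X e s = ∀ a b → (col X a b ≡ s → InQ X e s a b) × (InQ X e s a b → col X a b ≡ s)

Condition : (X : CC) → (e₁ e₀ : Rel X) → Set
Condition X e₁ e₀ = ∀ s → (∀ a b → col X a b ≡ s → ¬ E X e₁ a b) → InRad X e₀ s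

IsoFull : (X X' : CC) → AlgIso X X' → Fin (n X) → Fin (n X') → Set
IsoFull X X' φ α α' = Σ (Fin (n X) ↔ Fin (n X')) λ f →
  (∀ a b → col X' (Inverse.to f a) (Inverse.to f b) ≡ φ⟨ φ ⟩ (col X a b))
  × Inverse.to f α ≡ α'

-- Quotients Ω/e₀ are represented by representatives: a map f : Ω → Ω'
-- represents the map  aE₀ ↦ (f a)E'₀ on classes.  f is (a representative
-- of) an element of Iso_{α₀,α'₀}(X₀, X'₀, φ₀) iff the class map is well
-- defined and injective, surjective, maps s_{Ω/e₀} onto φ(s)_{Ω'/e'₀},
-- and sends α₀ to α'₀.
IsQIso : (X X' : CC) → AlgIso X X' → Rel X → Fin (n X) → Fin (n X') →
         (Fin (n X) → Fin (n X')) → Set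
IsQIso X X' φ e₀ α α' f =
  (∀ a b → (E X e₀ a b → E X' e₀' (f a) (f b)) × (E X' e₀' (f a) (f b) → E X e₀ a b))
  × (∀ a' → ∃ λ a → E X' e₀' (f a) a')
  × (∀ s a b → (InQ X e₀ s a b → InQ X' e₀' (φ⟨ φ ⟩ s) (f a) (f b))
             × (InQ X' e₀' (φ⟨ φ ⟩ s) (f a) (f b) → InQ X e₀ s a b))
  × E X' e₀' (f α) α'
  where e₀' = φRel φ e₀

IsoQ : (X X' : CC) → AlgIso X X' → Rel X → Fin (n X) → Fin (n X') → Set
IsoQ X X' φ e₀ α α' = Σ (Fin (n X) → Fin (n X')) (IsQIso X X' φ e₀ α α')

Cls : (X : CC) → Rel X → Fin (n X) → Set
Cls X e α = Σ (Fin (n X)) λ b → E X e α b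

IsRIso : (X X' : CC) → (φ : AlgIso X X') → (e₁ : Rel X) → (α : Fin (n X)) → (α' : Fin (n X')) →
         Cls X e₁ α ↔ Cls X' (φRel φ e₁) α' → Set
IsRIso X X' φ e₁ α α' g =
  (∀ x y → col X' (proj₁ (Inverse.to g x)) (proj₁ (Inverse.to g y)) ≡ φ⟨ φ ⟩ (col X (proj₁ x) (proj₁ y)))
  × (∀ x → proj₁ x ≡ α → proj₁ (Inverse.to g x) ≡ α')

IsoR : (X X' : CC) → AlgIso X X' → Rel X → Fin (n X) → Fin (n X') → Set
IsoR X X' φ e₁ α α' = Σ (Cls X e₁ α ↔ Cls X' (φRel φ e₁) α') (IsRIso X X' φ e₁ α α')

-- Bijections Δ₀ → Δ'₀ are represented by maps
-- h : Δ → Ω' (h x representing the image of the class x e₀); two such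
-- represent the same bijection iff h x e'₀ h' x for all x ∈ Δ.

QMapsΔ : (X X' : CC) → AlgIso X X' → (e₀ e₁ : Rel X) → Fin (n X) → Fin (n X') →
         (Fin (n X) → Fin (n X')) → Set
QMapsΔ X X' φ e₀ e₁ α α' f =
  (∀ b → E X e₁ α b → E X' (φRel φ e₁) α' (f b))
  × (∀ b' → E X' (φRel φ e₁) α' b' → ∃ λ b → E X e₁ α b × E X' (φRel φ e₀) (f b) b')

RMapsClasses : (X X' : CC) → (φ : AlgIso X X') → (e₀ e₁ : Rel X) → (α : Fin (n X)) → (α' : Fin (n X')) →
               Cls X e₁ α ↔ Cls X' (φRel φ e₁) α' → Set
RMapsClasses X X' φ e₀ e₁ α α' g =
  (∀ x y → E X e₀ (proj₁ x) (proj₁ y) →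
     E X' (φRel φ e₀) (proj₁ (Inverse.to g x)) (proj₁ (Inverse.to g y)))
  × (∀ x y' → E X' (φRel φ e₀) (proj₁ (Inverse.to g x)) (proj₁ y') →
     ∃ λ y → E X e₀ (proj₁ x) (proj₁ y) × Inverse.to g y ≡ y')

SameOnΔ₀ : (X X' : CC) → (φ : AlgIso X X') → (e₀ e₁ : Rel X) → (α : Fin (n X)) → (α' : Fin (n X')) →
           (Fin (n X) → Fin (n X')) → Cls X e₁ α ↔ Cls X' (φRel φ e₁) α' → Set
SameOnΔ₀ X X' φ e₀ e₁ α α' f g =
  ∀ x → E X' (φRel φ e₀) (f (proj₁ x)) (proj₁ (Inverse.to g x))

RestrictionsAgree : (X X' : CC) → AlgIso X X' → (e₀ e₁ : Rel X) → Fin (n X) → Fin (n X') → Set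
RestrictionsAgree X X' φ e₀ e₁ α α' =
  (∀ f → IsQIso X X' φ e₀ α α' f → QMapsΔ X X' φ e₀ e₁ α α' f →
     ∃ λ g → IsRIso X X' φ e₁ α α' g × RMapsClasses X X' φ e₀ e₁ α α' g
           × SameOnΔ₀ X X' φ e₀ e₁ α α' f g)
  × (∀ g → IsRIso X X' φ e₁ α α' g → RMapsClasses X X' φ e₀ e₁ α α' g →
     ∃ λ f → IsQIso X X' φ e₀ α α' f × QMapsΔ X X' φ e₀ e₁ α α' f
           × SameOnΔ₀ X X' φ e₀ e₁ α α' f g)

module Submission where

-- (2) ⇔ (3) is the hypothesis read at α, α', once one checks that
-- isomorphisms of either kind automatically map Δ₀ onto Δ'₀.  (1) ⇒ (2) passes
-- to e₀-classes.  For (2) ⇒ (1), the hypothesis turns a quotient isomorphism f₀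
-- into an isomorphism of X_Δ inducing f₀ on Δ/e₀, for every e₁-class Δ; glued
-- along fixed class representatives these give a bijection Ω → Ω' respecting
-- all colours inside e₁.  A colour s outside e₁ satisfies e₀ ⊆ rad(s) by the
-- e₁/e₀-condition, so it is a union of products of e₀-classes and is respected
-- because f₀ respects s_{Ω/e₀}.

open import Defs
open import Data.Bool using (Bool; true; false; T; T?)
open import Data.Bool.Properties using (T-irrelevant)
open import Data.Empty using (⊥-elim)
open import Data.Fin using (Fin; _≟_)
open import Data.List using (List; []; _∷_; filter; allFin; findᵇ)
open import Data.List.Membership.Propositional using (_∈_)
open import Data.List.Membership.Propositional.Properties using (∈-filter⁺; ∈-filter⁻; ∈-allFin; ∈-length)
open import Data.List.Relation.Unary.Any using (here; there)
open import Data.Maybe using (fromMaybe)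
open import Data.Nat using (ℕ)
open import Data.Nat.Properties using (m<n⇒n≢0)
open import Data.Product using (Σ; ∃; ∃₂; _×_; _,_; proj₁; proj₂; map₂)
open import Data.Sum using ([_,_]′)
open import Function.Base using (_∘_)
open import Function.Bundles using (Inverse; Injection; _↔_; _⇔_; mk⇔; mk↔ₛ′)
open import Function.Properties.Inverse using (Inverse⇒Injection)
open import Relation.Nullary using (¬_; yes; no)
open import Relation.Nullary.Decidable using (toSum; _×-dec_)
open import Relation.Unary using (Decidable)
open import Relation.Binary.PropositionalEquality
  using (_≡_; _≢_; refl; sym; trans; cong; cong₂; subst; module ≡-Reasoning)
open import Relation.Binary.Structures using (IsEquivalence)

module _ {n r : ℕ} (c : Fin n → Fin n → Fin r) (s t : Fin r) (a b : Fin n) where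

  private
    path? : Decidable (λ γ → c a γ ≡ s × c γ b ≡ t)
    path? γ = (c a γ ≟ s) ×-dec (c γ b ≟ t)

  path⇒isn≢0 : ∀ γ → c a γ ≡ s → c γ b ≡ t → isn c s t a b ≢ 0
  path⇒isn≢0 γ p q = m<n⇒n≢0 (∈-length (∈-filter⁺ path? (∈-allFin γ) (p , q)))

  isn≢0⇒path : isn c s t a b ≢ 0 → ∃ λ γ → c a γ ≡ s × c γ b ≡ t
  isn≢0⇒path isn≢0 with filter path? (allFin n) in eq
  ... | []    = ⊥-elim (isn≢0 refl)
  ... | γ ∷ _ = γ , proj₂ (∈-filter⁻ path? {xs = allFin n} (subst (γ ∈_) (sym eq) (here refl)))

module _ {A : Set} where

  fromMaybe-findᵇ-sound : ∀ (p : A → Bool) {d} xs → T (p d) → T (p (fromMaybe d (findᵇ p xs)))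
  fromMaybe-findᵇ-sound p []       pd = pd
  fromMaybe-findᵇ-sound p (x ∷ xs) pd with p x in px
  ... | true  = subst T (sym px) _
  ... | false = fromMaybe-findᵇ-sound p xs pd

  fromMaybe-findᵇ-cong : ∀ (p q : A → Bool) {x d d' xs} →
                         (∀ z → T (p z) → T (q z)) → (∀ z → T (q z) → T (p z)) → x ∈ xs → T (p x) →
                         fromMaybe d (findᵇ p xs) ≡ fromMaybe d' (findᵇ q xs)
  fromMaybe-findᵇ-cong p q {xs = y ∷ _} p⇒q q⇒p x∈ px with p y in py | q y in qy
  ... | true  | true  = refl
  ... | true  | false = ⊥-elim (subst T qy (p⇒q y (subst T (sym py) _)))
  ... | false | true  = ⊥-elim (subst T py (q⇒p y (subst T (sym qy) _)))
  fromMaybe-findᵇ-cong p q p⇒q q⇒p (here refl) px | false | false = ⊥-elim (subst T py px)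
  fromMaybe-findᵇ-cong p q p⇒q q⇒p (there x∈) px | false | false = fromMaybe-findᵇ-cong p q p⇒q q⇒p x∈ px

module ClassRepresentatives {A : Set} (_≈ᵇ_ : A → A → Bool)
                            (≈-isEquivalence : IsEquivalence (λ x y → T (x ≈ᵇ y)))
                            (xs : List A) (xs-complete : ∀ x → x ∈ xs) (α : A) where

  open IsEquivalence ≈-isEquivalence renaming (refl to ≈-refl; sym to ≈-sym; trans to ≈-trans)

  -- α is searched first, so that the class of α is represented by α itself.
  rep : A → A
  rep x = fromMaybe x (findᵇ (_≈ᵇ x) (α ∷ xs))

  rep-≈ : ∀ x → T (rep x ≈ᵇ x)
  rep-≈ x = fromMaybe-findᵇ-sound (_≈ᵇ x) (α ∷ xs) ≈-refl

  rep-cong : ∀ {x y} → T (x ≈ᵇ y) → rep x ≡ rep y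
  rep-cong x≈y = fromMaybe-findᵇ-cong _ _ (λ _ z≈x → ≈-trans z≈x x≈y) (λ _ z≈y → ≈-trans z≈y (≈-sym x≈y))
                                       (there (xs-complete _)) ≈-refl

  rep-α : rep α ≡ α
  rep-α with α ≈ᵇ α in α≈α
  ... | true  = refl
  ... | false = ⊥-elim (subst T α≈α ≈-refl)

module _ {X X' : CC} (φ : AlgIso X X') where

  private
    c : Fin (n X) → Fin (n X) → Fin (r X)
    c = col X
    c' : Fin (n X') → Fin (n X') → Fin (r X')
    c' = col X'
    φ̂ : Fin (r X) → Fin (r X')
    φ̂ = φ⟨ φ ⟩
    φ⁻¹ : Fin (r X') → Fin (r X)
    φ⁻¹ = Inverse.from (bij φ)

  φ̂∘φ⁻¹ : ∀ t' → φ̂ (φ⁻¹ t') ≡ t'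
  φ̂∘φ⁻¹ = Inverse.strictlyInverseˡ (bij φ)

  φ̂-injective : ∀ {s t} → φ̂ s ≡ φ̂ t → s ≡ t
  φ̂-injective = Injection.injective (Inverse⇒Injection (bij φ))

  φ̂-realised : ∀ a' b' → ∃₂ λ a b → φ̂ (c a b) ≡ c' a' b'
  φ̂-realised a' b' with partition X (φ⁻¹ (c' a' b'))
  ... | a , b , eq = a , b , trans (cong φ̂ eq) (φ̂∘φ⁻¹ _)

  triangle-image : ∀ {a b a' b'} γ → φ̂ (c a b) ≡ c' a' b' →
                   ∃ λ γ' → c' a' γ' ≡ φ̂ (c a γ) × c' γ' b' ≡ φ̂ (c γ b)
  triangle-image {a} {b} {a'} {b'} γ eq =
    isn≢0⇒path c' _ _ a' b' λ isn'≡0 →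
      path⇒isn≢0 c _ _ a b γ refl refl (trans (pres φ _ _ a b a' b' eq) isn'≡0)

  triangle-preimage : ∀ {a b a' b'} γ' → φ̂ (c a b) ≡ c' a' b' →
                      ∃ λ γ → φ̂ (c a γ) ≡ c' a' γ' × φ̂ (c γ b) ≡ c' γ' b'
  triangle-preimage {a} {b} {a'} {b'} γ' eq with isn≢0⇒path c (φ⁻¹ (c' a' γ')) (φ⁻¹ (c' γ' b')) a b isn≢0
    where
    isn≢0 : isn c (φ⁻¹ (c' a' γ')) (φ⁻¹ (c' γ' b')) a b ≢ 0
    isn≢0 isn≡0 = path⇒isn≢0 c' _ _ a' b' γ' (sym (φ̂∘φ⁻¹ _)) (sym (φ̂∘φ⁻¹ _))
                    (trans (sym (pres φ _ _ a b a' b' eq)) isn≡0)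
  ... | γ , u , v = γ , trans (cong φ̂ u) (φ̂∘φ⁻¹ _) , trans (cong φ̂ v) (φ̂∘φ⁻¹ _)

  φ⁻¹-colour : ∀ {a b a' b'} → φ̂ (c a b) ≡ c' a' b' → φ⁻¹ (c' a' b') ≡ c a b
  φ⁻¹-colour eq = trans (cong φ⁻¹ (sym eq)) (Inverse.strictlyInverseʳ (bij φ) _)

  E⇒φE : ∀ e {a b a' b'} → φ̂ (c a b) ≡ c' a' b' → E X e a b → E X' (φRel φ e) a' b'
  E⇒φE e eq = subst (T ∘ e) (sym (φ⁻¹-colour eq))

  φE⇒E : ∀ e {a b a' b'} → φ̂ (c a b) ≡ c' a' b' → E X' (φRel φ e) a' b' → E X e a b
  φE⇒E e eq = subst (T ∘ e) (φ⁻¹-colour eq)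

  IsRIso⇒RMapsClasses : ∀ e₀ e₁ {α α' g} → IsRIso X X' φ e₁ α α' g → RMapsClasses X X' φ e₀ e₁ α α' g
  IsRIso⇒RMapsClasses e₀ e₁ {g = g} (g-colour , _) =
      (λ x y x~y → E⇒φE e₀ (sym (g-colour x y)) x~y)
    , (λ x y' gx~y' → Inverse.from g y'
         , φE⇒E e₀ (sym (g-colour x _)) (subst (E X' (φRel φ e₀) _ ∘ proj₁) (sym (g∘g⁻¹ y')) gx~y')
         , g∘g⁻¹ y')
    where
    g∘g⁻¹ : ∀ y' → Inverse.to g (Inverse.from g y') ≡ y'
    g∘g⁻¹ = Inverse.strictlyInverseˡ g

  IsoR⇒IsoQ : ∀ e₀ e₁ {α α'} → RestrictionsAgree X X' φ e₀ e₁ α α' →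
              IsoR X X' φ e₁ α α' → IsoQ X X' φ e₀ α α'
  IsoR⇒IsoQ e₀ e₁ {α} {α'} agree (g , g-iso) =
    map₂ proj₁ (proj₂ agree g g-iso (IsRIso⇒RMapsClasses e₀ e₁ {α} {α'} {g} g-iso))

module _ {X X' : CC} (sX : IsScheme X) (sX' : IsScheme X') (φ : AlgIso X X') where

  private
    c : Fin (n X) → Fin (n X) → Fin (r X)
    c = col X
    c' : Fin (n X') → Fin (n X') → Fin (r X')
    c' = col X'
    φ̂ : Fin (r X) → Fin (r X')
    φ̂ = φ⟨ φ ⟩
    φ⁻¹ : Fin (r X') → Fin (r X)
    φ⁻¹ = Inverse.from (bij φ)
    d : Fin (r X)
    d = proj₁ sX
    d' : Fin (r X')
    d' = proj₁ sX'

    c-diagonal : ∀ x → c x x ≡ d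
    c-diagonal x = proj₂ (proj₂ sX x x) refl

    c'-diagonal : ∀ x' → c' x' x' ≡ d'
    c'-diagonal x' = proj₂ (proj₂ sX' x' x') refl

    d-diagonal : ∀ {x y} → c x y ≡ d → x ≡ y
    d-diagonal = proj₁ (proj₂ sX _ _)

    d'-diagonal : ∀ {x' y'} → c' x' y' ≡ d' → x' ≡ y'
    d'-diagonal = proj₁ (proj₂ sX' _ _)

  φ̂-diagonal : φ̂ d ≡ d'
  φ̂-diagonal with partition X' d'
  ... | a' , _ with φ̂-realised φ a' a'
  ... | a , b , ab↦a'a' with triangle-image φ a ab↦a'a'
  ... | γ' , a'γ'≡φaa , γ'a'≡φab = begin
    φ̂ d         ≡⟨ cong φ̂ (c-diagonal a) ⟨
    φ̂ (c a a)   ≡⟨ a'γ'≡φaa ⟨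
    c' a' γ'    ≡⟨ cong (c' a') γ'≡a' ⟩
    c' a' a'    ≡⟨ c'-diagonal a' ⟩
    d'          ∎
    where
    open ≡-Reasoning
    γ'≡a' : γ' ≡ a'
    γ'≡a' = d'-diagonal (trans γ'a'≡φab (trans ab↦a'a' (c'-diagonal a')))

  φ̂-diagonal-colour : ∀ x a' → φ̂ (c x x) ≡ c' a' a'
  φ̂-diagonal-colour x a' = trans (cong φ̂ (c-diagonal x)) (trans φ̂-diagonal (sym (c'-diagonal a')))

  φRel-isParabolic : ∀ e → IsParabolic X e → IsParabolic X' (φRel φ e)
  φRel-isParabolic e e-parabolic = record { refl = refl' ; sym = sym' ; trans = trans' }
    where
    open IsEquivalence e-parabolic renaming (refl to ~-refl; sym to ~-sym; trans to ~-trans)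
    refl' : ∀ {a'} → E X' (φRel φ e) a' a'
    refl' {a'} = E⇒φE φ e (φ̂-diagonal-colour (proj₁ (φ̂-realised φ a' a')) a') ~-refl
    sym' : ∀ {a' b'} → E X' (φRel φ e) a' b' → E X' (φRel φ e) b' a'
    sym' {a'} {b'} a'~b' with φ̂-realised φ a' a'
    ... | x , _ with triangle-preimage φ b' (φ̂-diagonal-colour x a')
    ... | γ , xγ↦a'b' , γx↦b'a' = E⇒φE φ e γx↦b'a' (~-sym (φE⇒E φ e xγ↦a'b' a'~b'))
    trans' : ∀ {a' b' c''} → E X' (φRel φ e) a' b' → E X' (φRel φ e) b' c'' → E X' (φRel φ e) a' c''
    trans' {a'} {b'} {c''} a'~b' b'~c'' with φ̂-realised φ a' c''
    ... | a , b , ab↦a'c'' with triangle-preimage φ b' ab↦a'c''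
    ... | γ , aγ↦a'b' , γb↦b'c'' =
      E⇒φE φ e ab↦a'c'' (~-trans (φE⇒E φ e aγ↦a'b' a'~b') (φE⇒E φ e γb↦b'c'' b'~c''))

  colour-preserving⇒injective : ∀ (f : Fin (n X) → Fin (n X')) → (∀ x y → c' (f x) (f y) ≡ φ̂ (c x y)) →
                                ∀ {x y} → f x ≡ f y → x ≡ y
  colour-preserving⇒injective f f-colour {x} {y} fx≡fy = d-diagonal (φ̂-injective φ (begin
    φ̂ (c x y)        ≡⟨ f-colour x y ⟨
    c' (f x) (f y)   ≡⟨ cong (c' (f x)) fx≡fy ⟨
    c' (f x) (f x)   ≡⟨ c'-diagonal (f x) ⟩
    d'               ≡⟨ φ̂-diagonal ⟨
    φ̂ d              ∎))
    where open ≡-Reasoning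

  φRel-rad : ∀ e {s} → IsParabolic X e → InRad X e s →
             ∀ {a' b' a₁ b₁} → E X' (φRel φ e) a' a₁ → E X' (φRel φ e) b' b₁ →
             c' a₁ b₁ ≡ φ̂ s → c' a' b' ≡ φ̂ s
  φRel-rad e {s} e-parabolic rad {a'} {b'} {a₁} {b₁} a'~a₁ b'~b₁ a₁b₁≡φs with φ̂-realised φ a' b'
  ... | a , b , ab↦a'b' with triangle-preimage φ a₁ ab↦a'b'
  ... | γ , aγ↦a'a₁ , γb↦a₁b' with triangle-preimage φ b₁ γb↦a₁b'
  ... | δ , γδ↦a₁b₁ , δb↦b₁b' = trans (sym ab↦a'b') (cong φ̂ (proj₂ (rad a b) ab∈s/e))
    where
    open IsEquivalence e-parabolic using () renaming (sym to ~-sym)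
    open IsEquivalence (φRel-isParabolic e e-parabolic) using () renaming (sym to ~'-sym)
    ab∈s/e : InQ X e s a b
    ab∈s/e = γ , δ , φE⇒E φ e aγ↦a'a₁ a'~a₁ , ~-sym (φE⇒E φ e δb↦b₁b' (~'-sym b'~b₁))
           , φ̂-injective φ (trans γδ↦a₁b₁ a₁b₁≡φs)

  module _ (e₀ : Rel X) (e₀-parabolic : IsParabolic X e₀) where

    private
      E' : Fin (n X') → Fin (n X') → Set
      E' = E X' (φRel φ e₀)
      open IsEquivalence e₀-parabolic using () renaming (refl to ~₀-refl)
      open IsEquivalence (φRel-isParabolic e₀ e₀-parabolic) using ()
        renaming (refl to ~₀'-refl; sym to ~₀'-sym; trans to ~₀'-trans)

    IsoFull⇒IsoQ : ∀ {α α'} → IsoFull X X' φ α α' → IsoQ X X' φ e₀ α α'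
    IsoFull⇒IsoQ {α} {α'} (f , f-colour , fα≡α') =
        F
      , (λ a b → E⇒φE φ e₀ (sym (f-colour a b)) , φE⇒E φ e₀ (sym (f-colour a b)))
      , (λ a' → G a' , subst (λ z → E' z a') (sym (F∘G a')) ~₀'-refl)
      , (λ s a b → push s a b , pull s a b)
      , subst (λ z → E' z α') (sym fα≡α') ~₀'-refl
      where
      F : Fin (n X) → Fin (n X')
      F = Inverse.to f
      G : Fin (n X') → Fin (n X)
      G = Inverse.from f
      F∘G : ∀ x' → F (G x') ≡ x'
      F∘G = Inverse.strictlyInverseˡ f
      E'⇒E : ∀ {a x'} → E' (F a) x' → E X e₀ a (G x')
      E'⇒E {a} {x'} a~x' = φE⇒E φ e₀ (sym (f-colour a (G x'))) (subst (E' (F a)) (sym (F∘G x')) a~x')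
      push : ∀ s a b → InQ X e₀ s a b → InQ X' (φRel φ e₀) (φ̂ s) (F a) (F b)
      push s a b (a₁ , b₁ , a~a₁ , b~b₁ , a₁b₁∈s) =
        F a₁ , F b₁ , E⇒φE φ e₀ (sym (f-colour a a₁)) a~a₁ , E⇒φE φ e₀ (sym (f-colour b b₁)) b~b₁
             , trans (f-colour a₁ b₁) (cong φ̂ a₁b₁∈s)
      pull : ∀ s a b → InQ X' (φRel φ e₀) (φ̂ s) (F a) (F b) → InQ X e₀ s a b
      pull s a b (a₁ , b₁ , a~a₁ , b~b₁ , a₁b₁∈φs) =
        G a₁ , G b₁ , E'⇒E a~a₁ , E'⇒E b~b₁
             , φ̂-injective φ (trans (sym (f-colour (G a₁) (G b₁)))
                                   (trans (cong₂ c' (F∘G a₁) (F∘G b₁)) a₁b₁∈φs))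

    IsQIso⇒InQ-image : ∀ {α α' f} → IsQIso X X' φ e₀ α α' f →
                       ∀ a b → InQ X' (φRel φ e₀) (φ̂ (c a b)) (f a) (f b)
    IsQIso⇒InQ-image (_ , _ , f-InQ , _) a b = proj₁ (f-InQ (c a b) a b) (a , b , ~₀-refl , ~₀-refl , refl)

    module _ (e₁ : Rel X) (e₁-parabolic : IsParabolic X e₁) (e₀⊆e₁ : RelSub X e₀ e₁) where

      open IsEquivalence e₁-parabolic using () renaming (refl to ~-refl; sym to ~-sym; trans to ~-trans)
      open IsEquivalence (φRel-isParabolic e₁ e₁-parabolic) using () renaming (sym to ~'-sym; trans to ~'-trans)

      φRel-⊆ : ∀ {a' b'} → E' a' b' → E X' (φRel φ e₁) a' b'
      φRel-⊆ {a'} {b'} = e₀⊆e₁ (φ⁻¹ (c' a' b'))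

      IsQIso⇒E-preserved : ∀ {α α' f a b} → IsQIso X X' φ e₀ α α' f → E X e₁ a b → E X' (φRel φ e₁) (f a) (f b)
      IsQIso⇒E-preserved {a = a} {b} f-iso a~b with IsQIso⇒InQ-image f-iso a b
      ... | a₁ , b₁ , fa~a₁ , fb~b₁ , a₁b₁≡φab =
        ~'-trans (φRel-⊆ fa~a₁) (~'-trans (E⇒φE φ e₁ (sym a₁b₁≡φab) a~b) (~'-sym (φRel-⊆ fb~b₁)))

      IsQIso⇒E-reflected : ∀ {α α' f a b} → IsQIso X X' φ e₀ α α' f → E X' (φRel φ e₁) (f a) (f b) → E X e₁ a b
      IsQIso⇒E-reflected {f = f} {a} {b} (_ , _ , f-InQ , _) fa~fb
        with proj₂ (f-InQ (φ⁻¹ (c' (f a) (f b))) a b) (f a , f b , ~₀'-refl , ~₀'-refl , sym (φ̂∘φ⁻¹ φ _))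
      ... | a₁ , b₁ , a~a₁ , b~b₁ , a₁b₁≡s =
        ~-trans (e₀⊆e₁ _ a~a₁)
                (~-trans (φE⇒E φ e₁ (trans (cong φ̂ a₁b₁≡s) (φ̂∘φ⁻¹ φ _)) fa~fb) (~-sym (e₀⊆e₁ _ b~b₁)))

      IsQIso⇒QMapsΔ : ∀ {α α' f} → IsQIso X X' φ e₀ α α' f → QMapsΔ X X' φ e₀ e₁ α α' f
      IsQIso⇒QMapsΔ f-iso@(_ , f-onto , _ , fα~α') =
          (λ b α~b → ~'-trans (~'-sym (φRel-⊆ fα~α')) (IsQIso⇒E-preserved f-iso α~b))
        , λ b' α'~b' → let (a , fa~b') = f-onto b' in
            a , IsQIso⇒E-reflected f-iso (~'-trans (φRel-⊆ fα~α') (~'-trans α'~b' (~'-sym (φRel-⊆ fa~b')))) , fa~b'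

      IsoQ⇒IsoR : ∀ {α α'} → RestrictionsAgree X X' φ e₀ e₁ α α' →
                  IsoQ X X' φ e₀ α α' → IsoR X X' φ e₁ α α'
      IsoQ⇒IsoR agree (f , f-iso) = map₂ proj₁ (proj₁ agree f f-iso (IsQIso⇒QMapsΔ f-iso))

      module Gluing (condition : Condition X e₁ e₀) (agree : ∀ β β' → RestrictionsAgree X X' φ e₀ e₁ β β')
                    {α α'} (f₀ : Fin (n X) → Fin (n X')) (f₀-iso : IsQIso X X' φ e₀ α α' f₀) where

        -- only at α is the image of β forced; elsewhere any point of the e'₀-class of f₀ β will do
        target : ∀ β → Σ (Fin (n X')) (E' (f₀ β))
        target β with β ≟ α
        ... | yes refl = α' , proj₂ (proj₂ (proj₂ f₀-iso))
        ... | no _     = f₀ β , ~₀'-refl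

        target-α : proj₁ (target α) ≡ α'
        target-α with α ≟ α
        ... | yes refl = refl
        ... | no α≢α   = ⊥-elim (α≢α refl)

        f₀-onto : ∀ y' → ∃ λ a → E' (f₀ a) y'
        f₀-onto = proj₁ (proj₂ f₀-iso)

        f₀-iso-at : ∀ β → IsQIso X X' φ e₀ β (proj₁ (target β)) f₀
        f₀-iso-at β = let (f₀-E , _ , f₀-InQ , _) = f₀-iso in f₀-E , f₀-onto , f₀-InQ , proj₂ (target β)

        local : ∀ β → ∃ λ g → IsRIso X X' φ e₁ β (proj₁ (target β)) g
                            × RMapsClasses X X' φ e₀ e₁ β (proj₁ (target β)) g
                            × SameOnΔ₀ X X' φ e₀ e₁ β (proj₁ (target β)) f₀ g
        local β = proj₁ (agree β (proj₁ (target β))) f₀ (f₀-iso-at β) (IsQIso⇒QMapsΔ (f₀-iso-at β))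

        image : ∀ β x → E X e₁ β x → Fin (n X')
        image β x β~x = proj₁ (Inverse.to (proj₁ (local β)) (x , β~x))

        image-irrelevant : ∀ {β γ x} → β ≡ γ → (β~x : E X e₁ β x) (γ~x : E X e₁ γ x) →
                           image β x β~x ≡ image γ x γ~x
        image-irrelevant refl β~x γ~x = cong (image _ _) (T-irrelevant β~x γ~x)

        image-colour : ∀ {β x y} (β~x : E X e₁ β x) (β~y : E X e₁ β y) →
                       c' (image β x β~x) (image β y β~y) ≡ φ̂ (c x y)
        image-colour β~x β~y = proj₁ (proj₁ (proj₂ (local _))) (_ , β~x) (_ , β~y)

        f₀~image : ∀ {β x} (β~x : E X e₁ β x) → E' (f₀ x) (image β x β~x)
        f₀~image β~x = proj₂ (proj₂ (proj₂ (local _))) (_ , β~x)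

        open ClassRepresentatives (λ x y → e₁ (c x y)) e₁-parabolic (allFin (n X)) ∈-allFin α

        F : Fin (n X) → Fin (n X')
        F x = image (rep x) x (rep-≈ x)

        F-colour-related : ∀ {x y} → E X e₁ x y → c' (F x) (F y) ≡ φ̂ (c x y)
        F-colour-related {x} {y} x~y = begin
          c' (F x) (F y)
            ≡⟨ cong (c' (F x)) (image-irrelevant (sym (rep-cong x~y)) (rep-≈ y) rep-x~y) ⟩
          c' (image (rep x) x (rep-≈ x)) (image (rep x) y rep-x~y)
            ≡⟨ image-colour (rep-≈ x) rep-x~y ⟩
          φ̂ (c x y)
            ∎
          where
          open ≡-Reasoning
          rep-x~y : E X e₁ (rep x) y
          rep-x~y = ~-trans (rep-≈ x) x~y

        F-colour-unrelated : ∀ {x y} → ¬ E X e₁ x y → c' (F x) (F y) ≡ φ̂ (c x y)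
        F-colour-unrelated {x} {y} x≁y = by-InQ (IsQIso⇒InQ-image f₀-iso x y)
          where
          rad : InRad X e₀ (c x y)
          rad = condition (c x y) λ a b ab≡xy a~b → x≁y (subst (T ∘ e₁) ab≡xy a~b)
          F~ : ∀ z {z₁} → E' (f₀ z) z₁ → E' (F z) z₁
          F~ z f₀z~z₁ = ~₀'-trans (~₀'-sym (f₀~image (rep-≈ z))) f₀z~z₁
          by-InQ : InQ X' (φRel φ e₀) (φ̂ (c x y)) (f₀ x) (f₀ y) → c' (F x) (F y) ≡ φ̂ (c x y)
          by-InQ (a₁ , b₁ , f₀x~a₁ , f₀y~b₁ , a₁b₁≡φxy) =
            φRel-rad e₀ e₀-parabolic rad (F~ x f₀x~a₁) (F~ y f₀y~b₁) a₁b₁≡φxy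

        F-colour : ∀ x y → c' (F x) (F y) ≡ φ̂ (c x y)
        F-colour x y = [ F-colour-related , F-colour-unrelated ]′ (toSum (T? (e₁ (c x y))))

        F-onto : ∀ y' → ∃ λ x → F x ≡ y'
        F-onto y' = proj₁ preimage , (begin
          F (proj₁ preimage)
            ≡⟨ image-irrelevant (rep-cong x~a) (rep-≈ (proj₁ preimage)) (proj₂ preimage) ⟩
          image β (proj₁ preimage) (proj₂ preimage)
            ≡⟨ cong proj₁ (Inverse.strictlyInverseˡ (proj₁ (local β)) (y' , β'~y')) ⟩
          y'
            ∎)
          where
          open ≡-Reasoning
          a : Fin (n X)
          a = proj₁ (f₀-onto y')
          β : Fin (n X)
          β = rep a
          β'~y' : E X' (φRel φ e₁) (proj₁ (target β)) y'
          β'~y' = ~'-trans (proj₁ (IsQIso⇒QMapsΔ (f₀-iso-at β)) a (rep-≈ a)) (φRel-⊆ (proj₂ (f₀-onto y')))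
          preimage : Cls X e₁ β
          preimage = Inverse.from (proj₁ (local β)) (y' , β'~y')
          x~a : E X e₁ (proj₁ preimage) a
          x~a = ~-trans (~-sym (proj₂ preimage)) (rep-≈ a)

        F-α : F α ≡ α'
        F-α = begin
          F α                        ≡⟨ image-irrelevant rep-α _ ~-refl ⟩
          image α α ~-refl           ≡⟨ proj₂ (proj₁ (proj₂ (local α))) (α , ~-refl) refl ⟩
          proj₁ (target α)           ≡⟨ target-α ⟩
          α'                         ∎
          where open ≡-Reasoning

        F-injective : ∀ {x y} → F x ≡ F y → x ≡ y
        F-injective = colour-preserving⇒injective F F-colour

        F-inverse : Fin (n X) ↔ Fin (n X')
        F-inverse = mk↔ₛ′ F (proj₁ ∘ F-onto) (proj₂ ∘ F-onto) (λ x → F-injective (proj₂ (F-onto (F x))))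

        glued : IsoFull X X' φ α α'
        glued = F-inverse , F-colour , F-α

      IsoQ⇒IsoFull : Condition X e₁ e₀ → (∀ β β' → RestrictionsAgree X X' φ e₀ e₁ β β') →
                     ∀ {α α'} → IsoQ X X' φ e₀ α α' → IsoFull X X' φ α α'
      IsoQ⇒IsoFull condition agree (f₀ , f₀-iso) = Gluing.glued condition agree f₀ f₀-iso

corollary5p4 : (X X' : CC) → IsScheme X → IsScheme X' → (φ : AlgIso X X') →
    (e₀ e₁ : Rel X) → IsParabolic X e₀ → IsParabolic X e₁ → RelSub X e₀ e₁ →
    Condition X e₁ e₀ →
    (∀ α α' → RestrictionsAgree X X' φ e₀ e₁ α α') →
    ∀ (α : Fin (n X)) (α' : Fin (n X')) →
      (IsoFull X X' φ α α' ⇔ IsoQ X X' φ e₀ α α') × (IsoQ X X' φ e₀ α α' ⇔ IsoR X X' φ e₁ α α')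
corollary5p4 X X' sX sX' φ e₀ e₁ e₀-parabolic e₁-parabolic e₀⊆e₁ condition agree α α' =
    mk⇔ (IsoFull⇒IsoQ sX sX' φ e₀ e₀-parabolic)
        (IsoQ⇒IsoFull sX sX' φ e₀ e₀-parabolic e₁ e₁-parabolic e₀⊆e₁ condition agree)
  , mk⇔ (IsoQ⇒IsoR sX sX' φ e₀ e₀-parabolic e₁ e₁-parabolic e₀⊆e₁ (agree α α'))
        (IsoR⇒IsoQ φ e₀ e₁ (agree α α'))
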